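{- Let $X=\mathrm{Sp}_{2n}(2)$ with $n\ge2$, and let $\Gamma$ be an $X$-strongly incidence-transitive code in $J(\mathcal{Q}^\epsilon,k)$, where $2\le k\le|\mathcal{Q}^\epsilon|-2$, such that for $\Delta\in\Gamma$ the stabiliser $X_\Delta$ is irreducible on $V$. Then $X_\Delta$ is not contained in a maximal $\mathcal C_8$-subgroup of $X$, i.e. $X_\Delta\not\le X_\psi$ for every $\psi\in\mathcal{Q}$.
   Context: $V=\mathbb{F}_2^{2n}$ with symplectic form $B$, $X=\mathrm{Sp}_{2n}(2)$ its isometry group. $\mathcal{Q}$ is the set of quadratic forms $\phi:V\to\mathbb{F}_2$ with $\phi(x+y)+\phi(x)+\phi(y)=B(x,y)$ and $\mathcal{Q}^\epsilon$ those of type $\epsilon\in\{+,-\}$, $|\mathcal{Q}^\epsilon|=2^{n-1}(2^n+\epsilon)$; $X$ acts by $\phi^g(x)=\phi(xg^{ -1})$. The maximal $\mathcal C_8$-subgroups of $X$ are the stabilisers $X_\psi\cong\mathrm{O}^{\pm}_{2n}(2)$ of forms $\psi\in\mathcal{Q}$. A code in $J(\mathcal{Q}^\epsilon,k)$ is a nonempty set of $k$-subsets of $\mathcal{Q}^\epsilon$; $X$-strongly incidence-transitive means $X$ preserves $\Gamma$, is transitive on it, and each $X_\Delta$ is transitive on $\Delta\times(\mathcal{Q}^\epsilon\setminus\Delta)$. Irreducible: no nonzero proper invariant subspace. -}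

module Defs where

open import Data.Bool using (Bool; true; false; _∧_; _xor_)
open import Data.Nat using (ℕ; zero; suc; _+_; _*_; _∸_; _^_; _≤_)
open import Data.Fin using (Fin)
open import Data.Vec using (Vec; []; _∷_; zipWith; replicate; lookup; tabulate)
open import Data.Fin using (_≟_)
open import Data.List using (List; length)
open import Data.List.Relation.Unary.All using (All)
open import Data.List.Relation.Unary.Any using (Any)
open import Data.List.Relation.Unary.AllPairs using (AllPairs)
open import Data.Product using (Σ; _×_; _,_; ∃)
open import Data.Sum using (_⊎_)
open import Relation.Binary.PropositionalEquality using (_≡_)
open import Relation.Nullary using (¬_; does)

-- The field F₂ is Bool, with addition _xor_ and multiplication _∧_.
-- V = F₂^{2n}, written as pairs (x , x') ∈ F₂^n × F₂^n with respect to the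
-- standard symplectic basis e₁,…,eₙ,f₁,…,fₙ.
V : ℕ → Set
V n = Vec Bool n × Vec Bool n

dot : ∀ {m} → Vec Bool m → Vec Bool m → Bool
dot [] [] = false
dot (a ∷ as) (b ∷ bs) = (a ∧ b) xor dot as bs

_⊕_ : ∀ {n} → V n → V n → V n
(x , x') ⊕ (y , y') = zipWith _xor_ x y , zipWith _xor_ x' y'

𝟎 : ∀ n → V n
𝟎 n = replicate n false , replicate n false

B : ∀ {n} → V n → V n → Bool
B (x , x') (y , y') = dot x y' xor dot x' y

-- X = Sp_{2n}(2): invertible linear maps V → V preserving B.
-- (Over F₂, additivity is linearity.)  Maps act on the right: x ↦ x g = act x.
record Sp (n : ℕ) : Set where
  field
    act    : V n → V n
    inv    : V n → V n
    inv-l  : ∀ x → inv (act x) ≡ x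
    inv-r  : ∀ x → act (inv x) ≡ x
    additive : ∀ x y → act (x ⊕ y) ≡ act x ⊕ act y
    isometry : ∀ x y → B (act x) (act y) ≡ B x y
open Sp public

Form : ℕ → Set
Form n = V n → Bool

_≈ᶠ_ : ∀ {n} → Form n → Form n → Set
φ ≈ᶠ ψ = ∀ x → φ x ≡ ψ x

IsQuadratic : ∀ {n} → Form n → Set
IsQuadratic {n} φ = ∀ x y → (φ (x ⊕ y) xor φ x) xor φ y ≡ B x y

unit : ∀ {n} → Fin n → Vec Bool n
unit i = tabulate (λ j → does (i ≟ j))

eᵢ fᵢ : ∀ {n} → Fin n → V n
eᵢ {n} i = unit i , replicate n false
fᵢ {n} i = replicate n false , unit i

arf : ∀ {n} → Form n → Bool
arf {n} φ = dot (tabulate (λ i → φ (eᵢ i))) (tabulate (λ i → φ (fᵢ i)))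

data Sign : Set where
  plus minus : Sign

-- Arf invariant 0 ↔ type + (O⁺), Arf invariant 1 ↔ type − (O⁻)
arfOf : Sign → Bool
arfOf plus  = false
arfOf minus = true

Q : ∀ {n} → Form n → Set
Q φ = IsQuadratic φ

Qε : ∀ {n} → Sign → Form n → Set
Qε ε φ = IsQuadratic φ × arf φ ≡ arfOf ε

cardQ : ℕ → Sign → ℕ
cardQ n plus  = 2 ^ (n ∸ 1) * (2 ^ n + 1)
cardQ n minus = 2 ^ (n ∸ 1) * (2 ^ n ∸ 1)

_^ᶠ_ : ∀ {n} → Form n → Sp n → Form n
(φ ^ᶠ g) x = φ (inv g x)

FSet : ℕ → Set₁
FSet n = Form n → Set

Respects : ∀ {n} → FSet n → Set
Respects S = ∀ φ ψ → φ ≈ᶠ ψ → S φ → S ψ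

HasSize : ∀ {n} → FSet n → ℕ → Set
HasSize {n} S k = Σ (List (Form n)) λ L →
  (length L ≡ k) × All S L × AllPairs (λ φ ψ → ¬ (φ ≈ᶠ ψ)) L ×
  (∀ φ → S φ → Any (λ ψ → φ ≈ᶠ ψ) L)

IsKSubset : ∀ {n} → Sign → ℕ → FSet n → Set
IsKSubset ε k Δ = Respects Δ × (∀ φ → Δ φ → Qε ε φ) × HasSize Δ k

-- image Δ^g = { φ^g : φ ∈ Δ }, i.e. φ ∈ Δ^g iff φ^{g⁻¹} ∈ Δ
_^ˢ_ : ∀ {n} → FSet n → Sp n → FSet n
(Δ ^ˢ g) φ = Δ (λ x → φ (act g x))

_≐_ : ∀ {n} → FSet n → FSet n → Set
S ≐ T = ∀ φ → (S φ → T φ) × (T φ → S φ)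

InStab : ∀ {n} → FSet n → Sp n → Set
InStab Δ g = (Δ ^ˢ g) ≐ Δ

InFormStab : ∀ {n} → Form n → Sp n → Set
InFormStab ψ g = (ψ ^ᶠ g) ≈ᶠ ψ

record StronglyIncidenceTransitive (n : ℕ) (ε : Sign) (k : ℕ) (Γ : FSet n → Set) : Set₁ where
  field
    nonempty   : Σ (FSet n) Γ
    ksubsets   : ∀ Δ → Γ Δ → IsKSubset ε k Δ
    -- X preserves Γ (Γ is taken up to equality of subsets)
    preserved  : ∀ Δ g → Γ Δ → Σ (FSet n) λ Δ' → Γ Δ' × (Δ' ≐ (Δ ^ˢ g))
    transitive : ∀ Δ Δ' → Γ Δ → Γ Δ' → Σ (Sp n) λ g → (Δ ^ˢ g) ≐ Δ'
    flagTrans  : ∀ Δ → Γ Δ → ∀ α β α' β' →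
                 Δ α → Qε ε β → ¬ Δ β → Δ α' → Qε ε β' → ¬ Δ β' →
                 Σ (Sp n) λ g → InStab Δ g × ((α ^ᶠ g) ≈ᶠ α') × ((β ^ᶠ g) ≈ᶠ β')

IsSubspace : ∀ {n} → (V n → Bool) → Set
IsSubspace {n} W = (W (𝟎 n) ≡ true) × (∀ x y → W x ≡ true → W y ≡ true → W (x ⊕ y) ≡ true)

Irreducible : ∀ {n} → (Sp n → Set) → Set
Irreducible {n} H = ∀ (W : V n → Bool) → IsSubspace W →
  (∀ g → H g → ∀ x → W x ≡ true → W (act g x) ≡ true) →
  (∀ x → W x ≡ true → x ≡ 𝟎 n) ⊎ (∀ x → W x ≡ true)

-- Suppose X_Δ ≤ X_ψ and list Δ as α₀, α₁, …. Two forms of 𝒬 differ by a linear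
-- functional, so the vectors on which every α ∈ Δ agrees with α₀ form a subspace W;
-- it is X_Δ-invariant, and proper since α₀ ≠ α₁, hence W = 0 by irreducibility.
-- For β ∈ 𝒬^ε ∖ Δ write β + ψ = B(v, ·). Flag-transitivity gives, for each α ∈ Δ,
-- some g ∈ X_Δ with α^g = α₀ and β^g = β; such a g also fixes ψ, hence v, so
-- α(v) = α₀(v). Thus v ∈ W = 0 and β = ψ: 𝒬^ε ⊆ Δ ∪ {ψ}, contradicting
-- k + 2 ≤ |𝒬^ε|, which is witnessed by the forms x·x' + a·x + b·x' with a·b = Arf.
module Submission where

open import Defs
open import Data.Nat using (ℕ; _≤_; _+_)
open import Relation.Nullary using (¬_)

open import Level using (0ℓ)
open import Data.Nat using (zero; suc; _*_; _∸_; _^_; _<_; z≤n; s≤s)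
import Data.Nat.Properties as ℕ
open import Data.Nat.ListAction using (sum)
open import Data.Nat.Tactic.RingSolver using () renaming (ring to ℕ-ring)
open import Data.Bool using (Bool; true; false; not; _∧_; _xor_)
import Data.Bool as Bool
open import Data.Bool.Properties
  using (xor-∧-commutativeRing; xor-identityˡ; xor-identityʳ; xor-comm; xor-same;
         ∧-comm; ∧-zeroʳ; ∧-identityʳ; not-involutive; T-≡)
open import Data.Fin as Fin using (Fin)
open import Data.Maybe using (just; nothing)
open import Data.Product using (Σ; _×_; _,_; proj₁; proj₂)
open import Data.Sum using (fromInj₁)
open import Data.Vec using (Vec; []; _∷_; zipWith; replicate; lookup; tabulate)
open import Data.Vec.Properties using (tabulate∘lookup; tabulate-cong; zipWith-identityˡ)
open import Data.List using (List; []; _∷_; [_]; map; concat; length)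
open import Data.List.Properties using (length-++; length-map; length-removeAt′)
open import Data.List.Relation.Unary.All as All using (All; []; _∷_; all?; lookupAny)
import Data.List.Relation.Unary.All.Properties as All
open import Data.List.Relation.Unary.AllPairs using ([]; _∷_)
open import Data.List.Relation.Unary.Any using (Any; here; there; index; _─_)
open import Data.List.Relation.Unary.Unique.Propositional using (Unique)
import Data.List.Relation.Unary.Unique.Propositional.Properties as Unique
open import Data.List.Relation.Unary.Unique.Setoid using () renaming (Unique to Unique[_])
import Data.List.Relation.Unary.Unique.Setoid.Properties as UniqueSetoid
open import Data.List.Relation.Binary.Disjoint.Propositional using (Disjoint)
open import Data.List.Membership.Propositional.Properties using (∈-map⁻)
import Data.List.Membership.Setoid as Membership
open import Function using (_∘_)
open import Function.Bundles using (Equivalence)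
open import Relation.Binary.Bundles using (Setoid)
open import Relation.Binary.PropositionalEquality
  using (_≡_; _≢_; refl; sym; trans; cong; cong₂; subst; module ≡-Reasoning)
import Relation.Binary.PropositionalEquality as ≡
open import Relation.Nullary using (Dec; yes; no; contradiction)
open import Relation.Nullary.Decidable using (isYes; toWitness; fromWitness; ¬¬-excluded-middle)
open import Relation.Nullary.Negation using (¬¬-map; ¬¬-Monad)
open import Tactic.RingSolver using (solve-∀)
open import Tactic.RingSolver.Core.AlmostCommutativeRing using (AlmostCommutativeRing; fromCommutativeRing)

𝔽₂ : AlmostCommutativeRing 0ℓ 0ℓ
𝔽₂ = fromCommutativeRing xor-∧-commutativeRing λ { false → just refl ; true → nothing }

xor≡false⇒≡ : ∀ {a b} → a xor b ≡ false → a ≡ b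
xor≡false⇒≡ {false} {false} _ = refl
xor≡false⇒≡ {true}  {true}  _ = refl
xor≡false⇒≡ {false} {true}  ()
xor≡false⇒≡ {true}  {false} ()

tabulate-false : ∀ m → tabulate {n = m} (λ _ → false) ≡ replicate m false
tabulate-false zero    = refl
tabulate-false (suc m) = cong (false ∷_) (tabulate-false m)

length-concat : ∀ {A : Set} (xss : List (List A)) → length (concat xss) ≡ sum (map length xss)
length-concat []         = refl
length-concat (xs ∷ xss) = trans (length-++ xs) (cong (length xs +_) (length-concat xss))

module _ {c ℓ} (S : Setoid c ℓ) where
  open Setoid S using (_≉_) renaming (sym to ≈-sym; trans to ≈-trans)
  open Membership S using (_∈_)

  ∈-─ : ∀ {x y ys} (y∈ys : y ∈ ys) → x ∈ ys → x ≉ y → x ∈ (ys ─ y∈ys)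
  ∈-─ (here y≈)  (here x≈)  x≉y = contradiction (≈-trans x≈ (≈-sym y≈)) x≉y
  ∈-─ (here _)   (there x∈) _   = x∈
  ∈-─ (there _)  (here x≈)  _   = here x≈
  ∈-─ (there y∈) (there x∈) x≉y = there (∈-─ y∈ x∈ x≉y)

  unique-⊆⇒length≤ : ∀ {xs ys} → Unique[ S ] xs → All (_∈ ys) xs → length xs ≤ length ys
  unique-⊆⇒length≤ [] [] = z≤n
  unique-⊆⇒length≤ {ys = ys} (x≉xs ∷ xs-unique) (x∈ys ∷ xs⊆ys) =
    subst (_ ≤_) (sym (length-removeAt′ ys (index x∈ys)))
      (s≤s (unique-⊆⇒length≤ xs-unique
             (All.zipWith (λ (x≉x′ , x′∈ys) → ∈-─ x∈ys x′∈ys (x≉x′ ∘ ≈-sym)) (x≉xs , xs⊆ys))))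

dot-comm : ∀ {m} (x y : Vec Bool m) → dot x y ≡ dot y x
dot-comm []      []      = refl
dot-comm (a ∷ x) (b ∷ y) = cong₂ _xor_ (∧-comm a b) (dot-comm x y)

dot-distribʳ-xor : ∀ {m} (u v w : Vec Bool m) → dot (zipWith _xor_ u v) w ≡ dot u w xor dot v w
dot-distribʳ-xor []      []      []      = refl
dot-distribʳ-xor (a ∷ u) (b ∷ v) (c ∷ w) =
  trans (cong (((a xor b) ∧ c) xor_) (dot-distribʳ-xor u v w)) (expand a b c (dot u w) (dot v w))
  where
  expand : ∀ a b c p q → ((a xor b) ∧ c) xor (p xor q) ≡ ((a ∧ c) xor p) xor ((b ∧ c) xor q)
  expand = solve-∀ 𝔽₂

dot-distribˡ-xor : ∀ {m} (w u v : Vec Bool m) → dot w (zipWith _xor_ u v) ≡ dot w u xor dot w v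
dot-distribˡ-xor w u v = begin
  dot w (zipWith _xor_ u v)  ≡⟨ dot-comm w _ ⟩
  dot (zipWith _xor_ u v) w  ≡⟨ dot-distribʳ-xor u v w ⟩
  dot u w xor dot v w        ≡⟨ cong₂ _xor_ (dot-comm u w) (dot-comm v w) ⟩
  dot w u xor dot w v        ∎
  where open ≡-Reasoning

dot-zeroʳ : ∀ {m} (x : Vec Bool m) → dot x (replicate m false) ≡ false
dot-zeroʳ []      = refl
dot-zeroʳ (a ∷ x) = cong₂ _xor_ (∧-zeroʳ a) (dot-zeroʳ x)

dot-zeroˡ : ∀ {m} (x : Vec Bool m) → dot (replicate m false) x ≡ false
dot-zeroˡ x = trans (dot-comm _ x) (dot-zeroʳ x)

dot-unit : ∀ {m} (x : Vec Bool m) (i : Fin m) → dot x (unit i) ≡ lookup x i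
dot-unit (a ∷ x) Fin.zero = begin
  (a ∧ true) xor dot x (tabulate (λ _ → false))
    ≡⟨ cong₂ _xor_ (∧-identityʳ a) (cong (dot x) (tabulate-false _)) ⟩
  a xor dot x (replicate _ false)  ≡⟨ cong (a xor_) (dot-zeroʳ x) ⟩
  a xor false                      ≡⟨ xor-identityʳ a ⟩
  a                                ∎
  where open ≡-Reasoning
dot-unit (a ∷ x) (Fin.suc i) = trans (cong (_xor dot x _) (∧-zeroʳ a)) (dot-unit x i)

⊕-identityˡ : ∀ {n} (x : V n) → 𝟎 n ⊕ x ≡ x
⊕-identityˡ (x , x') = cong₂ _,_ (zipWith-identityˡ xor-identityˡ x) (zipWith-identityˡ xor-identityˡ x')

B-zeroˡ : ∀ {n} (x : V n) → B (𝟎 n) x ≡ false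
B-zeroˡ (x , x') = cong₂ _xor_ (dot-zeroˡ x') (dot-zeroˡ x)

Linear : ∀ {n} → (V n → Bool) → Set
Linear ℓ = ∀ x y → ℓ (x ⊕ y) ≡ ℓ x xor ℓ y

linear-zero : ∀ {n} (ℓ : V n → Bool) → Linear ℓ → ℓ (𝟎 n) ≡ false
linear-zero {n} ℓ lin = trans (cong ℓ (sym (⊕-identityˡ (𝟎 n)))) (trans (lin _ _) (xor-same (ℓ (𝟎 n))))

module _ {n} (ℓ : V (suc n) → Bool) (lin : Linear ℓ) where
  private
    0s = replicate n false
    e₀ = eᵢ {suc n} Fin.zero
    f₀ = fᵢ {suc n} Fin.zero

    e₀≡ : e₀ ≡ (true ∷ 0s , false ∷ 0s)
    e₀≡ = cong (λ t → true ∷ t , false ∷ 0s) (tabulate-false n)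

    f₀≡ : f₀ ≡ (false ∷ 0s , true ∷ 0s)
    f₀≡ = cong (λ t → false ∷ 0s , true ∷ t) (tabulate-false n)

    e₀⊕f₀≡ : e₀ ⊕ f₀ ≡ (true ∷ 0s , true ∷ 0s)
    e₀⊕f₀≡ = trans (cong₂ _⊕_ e₀≡ f₀≡)
      (cong₂ _,_ (cong (true ∷_) (zipWith-identityˡ xor-identityˡ 0s))
                 (cong (true ∷_) (zipWith-identityˡ xor-identityˡ 0s)))

  linear-head : ∀ a a' → ℓ (a ∷ 0s , a' ∷ 0s) ≡ (ℓ e₀ ∧ a) xor (ℓ f₀ ∧ a')
  linear-head false false = trans (linear-zero ℓ lin) (sym (cong₂ _xor_ (∧-zeroʳ (ℓ e₀)) (∧-zeroʳ (ℓ f₀))))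
  linear-head true  false = trans (cong ℓ (sym e₀≡))
    (sym (trans (cong₂ _xor_ (∧-identityʳ (ℓ e₀)) (∧-zeroʳ (ℓ f₀))) (xor-identityʳ (ℓ e₀))))
  linear-head false true  = trans (cong ℓ (sym f₀≡))
    (sym (cong₂ _xor_ (∧-zeroʳ (ℓ e₀)) (∧-identityʳ (ℓ f₀))))
  linear-head true  true  = trans (cong ℓ (sym e₀⊕f₀≡))
    (trans (lin e₀ f₀) (sym (cong₂ _xor_ (∧-identityʳ (ℓ e₀)) (∧-identityʳ (ℓ f₀)))))

linear-expansion : ∀ {n} (ℓ : V n → Bool) → Linear ℓ → ∀ x x' →
  ℓ (x , x') ≡ dot (tabulate (λ i → ℓ (eᵢ i))) x xor dot (tabulate (λ i → ℓ (fᵢ i))) x'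
linear-expansion {zero}  ℓ lin []      []        = linear-zero ℓ lin
linear-expansion {suc n} ℓ lin (a ∷ x) (a' ∷ x') = begin
  ℓ (a ∷ x , a' ∷ x')                                  ≡⟨ cong ℓ split ⟩
  ℓ ((a ∷ 0s , a' ∷ 0s) ⊕ (false ∷ x , false ∷ x'))    ≡⟨ lin _ _ ⟩
  ℓ (a ∷ 0s , a' ∷ 0s) xor ℓ (false ∷ x , false ∷ x')
    ≡⟨ cong₂ _xor_ (linear-head ℓ lin a a') (linear-expansion _ lin′ x x') ⟩
  ((ℓ e₀ ∧ a) xor (ℓ f₀ ∧ a')) xor (dot ℓe x xor dot ℓf x')
    ≡⟨ regroup (ℓ e₀ ∧ a) (ℓ f₀ ∧ a') _ _ ⟩
  dot (ℓ e₀ ∷ ℓe) (a ∷ x) xor dot (ℓ f₀ ∷ ℓf) (a' ∷ x') ∎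
  where
  open ≡-Reasoning
  0s = replicate n false
  e₀ = eᵢ {suc n} Fin.zero
  f₀ = fᵢ {suc n} Fin.zero
  ℓe = tabulate (λ i → ℓ (eᵢ (Fin.suc i)))
  ℓf = tabulate (λ i → ℓ (fᵢ (Fin.suc i)))
  lin′ : Linear (λ (y , y') → ℓ (false ∷ y , false ∷ y'))
  lin′ (y , y') (z , z') = lin (false ∷ y , false ∷ y') (false ∷ z , false ∷ z')
  split : (a ∷ x , a' ∷ x') ≡ (a ∷ 0s , a' ∷ 0s) ⊕ (false ∷ x , false ∷ x')
  split = sym (cong₂ _,_ (cong₂ _∷_ (xor-identityʳ a) (zipWith-identityˡ xor-identityˡ x))
                         (cong₂ _∷_ (xor-identityʳ a') (zipWith-identityˡ xor-identityˡ x')))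
  regroup : ∀ p q r s → (p xor q) xor (r xor s) ≡ (p xor r) xor (q xor s)
  regroup = solve-∀ 𝔽₂

dual : ∀ {n} → (V n → Bool) → V n
dual ℓ = tabulate (λ i → ℓ (fᵢ i)) , tabulate (λ i → ℓ (eᵢ i))

B-dual : ∀ {n} (ℓ : V n → Bool) → Linear ℓ → ∀ x → B (dual ℓ) x ≡ ℓ x
B-dual ℓ lin (x , x') =
  trans (xor-comm (dot (tabulate (λ i → ℓ (fᵢ i))) x') _) (sym (linear-expansion ℓ lin x x'))

dual-B : ∀ {n} (u : V n) → dual (B u) ≡ u
dual-B (u , u') = cong₂ _,_
  (trans (tabulate-cong (λ i → trans (cong₂ _xor_ (dot-unit u i) (dot-zeroʳ u')) (xor-identityʳ _)))
         (tabulate∘lookup u))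
  (trans (tabulate-cong (λ i → cong₂ _xor_ (dot-zeroʳ u) (dot-unit u' i)))
         (tabulate∘lookup u'))

B-nondegenerate : ∀ {n} {u w : V n} → (∀ z → B u z ≡ B w z) → u ≡ w
B-nondegenerate {u = u} {w} h = begin
  u           ≡⟨ sym (dual-B u) ⟩
  dual (B u)  ≡⟨ cong₂ _,_ (tabulate-cong (λ i → h (fᵢ i))) (tabulate-cong (λ i → h (eᵢ i))) ⟩
  dual (B w)  ≡⟨ dual-B w ⟩
  w           ∎
  where open ≡-Reasoning

dual-fixed : ∀ {n} (g : Sp n) (ℓ : V n → Bool) → Linear ℓ → (∀ z → ℓ (inv g z) ≡ ℓ z) →
             inv g (dual ℓ) ≡ dual ℓ
dual-fixed g ℓ lin ℓ-inv = trans (cong (inv g) (sym acts)) (inv-l g _)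
  where
  open ≡-Reasoning
  v = dual ℓ
  acts : act g v ≡ v
  acts = B-nondegenerate λ z → begin
    B (act g v) z                   ≡⟨ cong (B (act g v)) (sym (inv-r g z)) ⟩
    B (act g v) (act g (inv g z))   ≡⟨ isometry g v (inv g z) ⟩
    B v (inv g z)                   ≡⟨ B-dual ℓ lin (inv g z) ⟩
    ℓ (inv g z)                     ≡⟨ ℓ-inv z ⟩
    ℓ z                             ≡⟨ sym (B-dual ℓ lin z) ⟩
    B v z                           ∎

quadratic-⊕ : ∀ {n} (φ : Form n) → IsQuadratic φ → ∀ x y → φ (x ⊕ y) ≡ (B x y xor φ x) xor φ y
quadratic-⊕ φ q x y =
  trans (cancel (φ (x ⊕ y)) (φ x) (φ y)) (cong (λ t → (t xor φ x) xor φ y) (q x y))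
  where
  cancel : ∀ a b c → a ≡ (((a xor b) xor c) xor b) xor c
  cancel = solve-∀ 𝔽₂

quadratic-zero : ∀ {n} (φ : Form n) → IsQuadratic φ → φ (𝟎 n) ≡ false
quadratic-zero {n} φ q = begin
  φ o                          ≡⟨ triple (φ o) ⟩
  (φ o xor φ o) xor φ o        ≡⟨ cong (λ t → (φ t xor φ o) xor φ o) (sym (⊕-identityˡ o)) ⟩
  (φ (o ⊕ o) xor φ o) xor φ o  ≡⟨ q o o ⟩
  B o o                        ≡⟨ B-zeroˡ o ⟩
  false                        ∎
  where
  open ≡-Reasoning
  o = 𝟎 n
  triple : ∀ a → a ≡ (a xor a) xor a
  triple = solve-∀ 𝔽₂

quadratic-difference-linear : ∀ {n} (φ ψ : Form n) → IsQuadratic φ → IsQuadratic ψ →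
                              Linear (λ x → φ x xor ψ x)
quadratic-difference-linear φ ψ qφ qψ x y =
  trans (cong₂ _xor_ (quadratic-⊕ φ qφ x y) (quadratic-⊕ ψ qψ x y)) (polarisation-cancels (B x y) _ _ _ _)
  where
  polarisation-cancels : ∀ b p q r s → ((b xor p) xor q) xor ((b xor r) xor s) ≡ (p xor r) xor (q xor s)
  polarisation-cancels = solve-∀ 𝔽₂

quadratic-agree-⊕ : ∀ {n} (α β : Form n) → IsQuadratic α → IsQuadratic β → ∀ {x y} →
                    α x ≡ β x → α y ≡ β y → α (x ⊕ y) ≡ β (x ⊕ y)
quadratic-agree-⊕ α β qα qβ {x} {y} αx≡βx αy≡βy = begin
  α (x ⊕ y)                ≡⟨ quadratic-⊕ α qα x y ⟩
  (B x y xor α x) xor α y  ≡⟨ cong₂ (λ s t → (B x y xor s) xor t) αx≡βx αy≡βy ⟩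
  (B x y xor β x) xor β y  ≡⟨ sym (quadratic-⊕ β qβ x y) ⟩
  β (x ⊕ y)                ∎
  where open ≡-Reasoning

agreement : ∀ {n} → Form n → List (Form n) → V n → Bool
agreement α₀ αs x = isYes (all? (λ α → α x Bool.≟ α₀ x) αs)

agreement⇒All : ∀ {n} (α₀ : Form n) {αs x} → agreement α₀ αs x ≡ true → All (λ α → α x ≡ α₀ x) αs
agreement⇒All α₀ {αs} {x} h = toWitness {a? = all? (λ α → α x Bool.≟ α₀ x) αs} (Equivalence.from T-≡ h)

All⇒agreement : ∀ {n} (α₀ : Form n) {αs x} → All (λ α → α x ≡ α₀ x) αs → agreement α₀ αs x ≡ true
All⇒agreement α₀ {αs} {x} h = Equivalence.to T-≡ (fromWitness {a? = all? (λ α → α x Bool.≟ α₀ x) αs} h)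

agreement-subspace : ∀ {n} {α₀ : Form n} {αs} → IsQuadratic α₀ → All IsQuadratic αs →
                     IsSubspace (agreement α₀ αs)
agreement-subspace {α₀ = α₀} qα₀ qαs =
  All⇒agreement α₀ (All.map (λ {α} qα → trans (quadratic-zero α qα) (sym (quadratic-zero α₀ qα₀))) qαs) ,
  λ x y x∈ y∈ → All⇒agreement α₀
    (All.zipWith (λ { {α} (qα , αx≡ , αy≡) → quadratic-agree-⊕ α α₀ qα qα₀ αx≡ αy≡ })
                 (qαs , All.zip (agreement⇒All α₀ x∈ , agreement⇒All α₀ y∈)))

agreement-proper : ∀ {n} {α₀ α₁ : Form n} {rest} → ¬ α₀ ≈ᶠ α₁ →
                   ¬ (∀ x → agreement α₀ (α₀ ∷ α₁ ∷ rest) x ≡ true)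
agreement-proper {α₀ = α₀} α₀≉α₁ full =
  α₀≉α₁ λ x → sym (All.head (All.tail (agreement⇒All α₀ (full x))))

-- Every form of 𝒬 is a standardForm, with Arf invariant a·b.
standardForm : ∀ {n} → V n → Form n
standardForm (a , b) (x , x') = (dot x x' xor dot a x) xor dot b x'

standardForm-quadratic : ∀ {n} (p : V n) → IsQuadratic (standardForm p)
standardForm-quadratic (a , b) (x , x') (y , y')
  rewrite dot-distribʳ-xor x y (zipWith _xor_ x' y') | dot-distribˡ-xor x x' y' | dot-distribˡ-xor y x' y'
        | dot-distribˡ-xor a x y | dot-distribˡ-xor b x' y'
  = trans (cross-terms (dot x x') (dot x y') (dot y x') (dot y y') (dot a x) (dot a y) (dot b x') (dot b y'))
          (cong (dot x y' xor_) (dot-comm y x'))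
  where
  cross-terms : ∀ p q r s t u v w →
    (((((p xor q) xor (r xor s)) xor (t xor u)) xor (v xor w)) xor ((p xor t) xor v)) xor ((s xor u) xor w)
    ≡ q xor r
  cross-terms = solve-∀ 𝔽₂

coefficients : ∀ {n} → Form n → V n
coefficients φ = tabulate (λ i → φ (eᵢ i)) , tabulate (λ i → φ (fᵢ i))

coefficients-standardForm : ∀ {n} (p : V n) → coefficients (standardForm p) ≡ p
coefficients-standardForm (a , b) = cong₂ _,_
  (trans (tabulate-cong λ i →
            trans (cong₂ _xor_ (cong₂ _xor_ (dot-zeroʳ (unit i)) (dot-unit a i)) (dot-zeroʳ b)) (xor-identityʳ _))
         (tabulate∘lookup a))
  (trans (tabulate-cong λ i → cong₂ _xor_ (cong₂ _xor_ (dot-zeroˡ (unit i)) (dot-zeroʳ a)) (dot-unit b i))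
         (tabulate∘lookup b))

standardForm-injective : ∀ {n} {p q : V n} → standardForm p ≈ᶠ standardForm q → p ≡ q
standardForm-injective {p = p} {q} h = begin
  p                              ≡⟨ sym (coefficients-standardForm p) ⟩
  coefficients (standardForm p)  ≡⟨ cong₂ _,_ (tabulate-cong (λ i → h (eᵢ i))) (tabulate-cong (λ i → h (fᵢ i))) ⟩
  coefficients (standardForm q)  ≡⟨ coefficients-standardForm q ⟩
  q                              ∎
  where open ≡-Reasoning

arf-standardForm : ∀ {n} (a b : Vec Bool n) → arf (standardForm (a , b)) ≡ dot a b
arf-standardForm a b = cong (λ (a , b) → dot a b) (coefficients-standardForm (a , b))

extend : ∀ {n} → Bool → Bool → V n → V (suc n)
extend s t (a , b) = s ∷ a , t ∷ b

pairsWithDot : (n : ℕ) → Bool → List (V n)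
pairsWithDot zero    false = [ [] , [] ]
pairsWithDot zero    true  = []
pairsWithDot (suc n) t     = concat
  ( map (extend false false) (pairsWithDot n t)
  ∷ map (extend false true)  (pairsWithDot n t)
  ∷ map (extend true  false) (pairsWithDot n t)
  ∷ map (extend true  true)  (pairsWithDot n (not t))
  ∷ [])

pairsWithDot-dot : ∀ n t → All (λ (a , b) → dot a b ≡ t) (pairsWithDot n t)
pairsWithDot-dot zero    false = refl ∷ []
pairsWithDot-dot zero    true  = []
pairsWithDot-dot (suc n) t     = All.concat⁺
  ( All.map⁺ (pairsWithDot-dot n t)
  ∷ All.map⁺ (pairsWithDot-dot n t)
  ∷ All.map⁺ (pairsWithDot-dot n t)
  ∷ All.map⁺ (All.map (λ e → trans (cong not e) (not-involutive t)) (pairsWithDot-dot n (not t)))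
  ∷ [])

extend-injective : ∀ {n s t} {p q : V n} → extend s t p ≡ extend s t q → p ≡ q
extend-injective {p = _ , _} {_ , _} refl = refl

extend-leading : ∀ {n s t s' t'} (p q : V n) → extend s t p ≡ extend s' t' q → (s , t) ≡ (s' , t')
extend-leading (_ , _) (_ , _) refl = refl

extend-disjoint : ∀ {n s t s' t'} {ps qs : List (V n)} → (s , t) ≢ (s' , t') →
                  Disjoint (map (extend s t) ps) (map (extend s' t') qs)
extend-disjoint st≢s't' (v∈ps , v∈qs) with ∈-map⁻ (extend _ _) v∈ps | ∈-map⁻ (extend _ _) v∈qs
... | p , _ , refl | q , _ , eq = st≢s't' (extend-leading p q eq)

pairsWithDot-unique : ∀ n t → Unique (pairsWithDot n t)
pairsWithDot-unique zero    false = [] ∷ []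
pairsWithDot-unique zero    true  = []
pairsWithDot-unique (suc n) t     = Unique.concat⁺
  ( extended (pairsWithDot-unique n t) ∷ extended (pairsWithDot-unique n t)
  ∷ extended (pairsWithDot-unique n t) ∷ extended (pairsWithDot-unique n (not t)) ∷ [])
  ( (extend-disjoint (λ ()) ∷ extend-disjoint (λ ()) ∷ extend-disjoint (λ ()) ∷ [])
  ∷ (extend-disjoint (λ ()) ∷ extend-disjoint (λ ()) ∷ [])
  ∷ (extend-disjoint (λ ()) ∷ [])
  ∷ [] ∷ [])
  where
  extended : ∀ {s t} {ps : List (V n)} → Unique ps → Unique (map (extend s t) ps)
  extended = Unique.map⁺ extend-injective

#pairsWithDot : ℕ → Bool → ℕ
#pairsWithDot n t = length (pairsWithDot n t)

#pairsWithDot-suc : ∀ n t → let N = #pairsWithDot n t in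
                    #pairsWithDot (suc n) t ≡ N + (N + (N + (#pairsWithDot n (not t) + 0)))
#pairsWithDot-suc n t = trans (length-concat (map (extend false false) P ∷ map (extend false true) P ∷
                                              map (extend true false) P ∷ map (extend true true) P′ ∷ []))
  (cong₂ _+_ (length-map _ P) (cong₂ _+_ (length-map _ P)
    (cong₂ _+_ (length-map _ P) (cong (_+ 0) (length-map _ P′)))))
  where
  P  = pairsWithDot n t
  P′ = pairsWithDot n (not t)

-- With p = 2ⁿ the counts are (p² + p)/2 and (p² − p)/2; the second is stated
-- additively, and each induction step adds p to both sides to avoid subtraction.
#pairsWithDot-closed : ∀ n → (2 * #pairsWithDot n false ≡ 2 ^ n * 2 ^ n + 2 ^ n)
                           × (2 * #pairsWithDot n true + 2 ^ n ≡ 2 ^ n * 2 ^ n)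
#pairsWithDot-closed zero    = refl , refl
#pairsWithDot-closed (suc n) = ℕ.+-cancelʳ-≡ p _ _ even , ℕ.+-cancelʳ-≡ p _ _ odd
  where
  open ≡-Reasoning
  Z = #pairsWithDot n false
  O = #pairsWithDot n true
  p = 2 ^ n
  IH = #pairsWithDot-closed n
  even : 2 * #pairsWithDot (suc n) false + p ≡ (2 * p * (2 * p) + 2 * p) + p
  even = begin
    2 * #pairsWithDot (suc n) false + p  ≡⟨ cong (λ c → 2 * c + p) (#pairsWithDot-suc n false) ⟩
    2 * (Z + (Z + (Z + (O + 0)))) + p    ≡⟨ regroup Z O p ⟩
    3 * (2 * Z) + (2 * O + p)            ≡⟨ cong₂ (λ a b → 3 * a + b) (proj₁ IH) (proj₂ IH) ⟩
    3 * (p * p + p) + p * p              ≡⟨ square p ⟩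
    (2 * p * (2 * p) + 2 * p) + p        ∎
    where
    regroup : ∀ Z O p → 2 * (Z + (Z + (Z + (O + 0)))) + p ≡ 3 * (2 * Z) + (2 * O + p)
    regroup = solve-∀ ℕ-ring
    square : ∀ p → 3 * (p * p + p) + p * p ≡ (2 * p * (2 * p) + 2 * p) + p
    square = solve-∀ ℕ-ring
  odd : (2 * #pairsWithDot (suc n) true + 2 * p) + p ≡ 2 * p * (2 * p) + p
  odd = begin
    (2 * #pairsWithDot (suc n) true + 2 * p) + p  ≡⟨ cong (λ c → (2 * c + 2 * p) + p) (#pairsWithDot-suc n true) ⟩
    (2 * (O + (O + (O + (Z + 0)))) + 2 * p) + p   ≡⟨ regroup Z O p ⟩
    3 * (2 * O + p) + 2 * Z                       ≡⟨ cong₂ (λ a b → 3 * a + b) (proj₂ IH) (proj₁ IH) ⟩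
    3 * (p * p) + (p * p + p)                     ≡⟨ square p ⟩
    2 * p * (2 * p) + p                           ∎
    where
    regroup : ∀ Z O p → (2 * (O + (O + (O + (Z + 0)))) + 2 * p) + p ≡ 3 * (2 * O + p) + 2 * Z
    regroup = solve-∀ ℕ-ring
    square : ∀ p → 3 * (p * p) + (p * p + p) ≡ 2 * p * (2 * p) + p
    square = solve-∀ ℕ-ring

#pairsWithDot≡cardQ : ∀ m ε → #pairsWithDot (suc m) (arfOf ε) ≡ cardQ (suc m) ε
#pairsWithDot≡cardQ m plus  =
  ℕ.*-cancelˡ-≡ _ _ 2 (trans (proj₁ (#pairsWithDot-closed (suc m))) (factor (2 ^ m)))
  where
  factor : ∀ p → 2 * p * (2 * p) + 2 * p ≡ 2 * (p * (2 * p + 1))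
  factor = solve-∀ ℕ-ring
#pairsWithDot≡cardQ m minus = ℕ.*-cancelˡ-≡ _ _ 2 (ℕ.+-cancelʳ-≡ (2 * p) _ _ (begin
  2 * #pairsWithDot (suc m) true + 2 * p  ≡⟨ proj₂ (#pairsWithDot-closed (suc m)) ⟩
  2 * p * (2 * p)                         ≡⟨ cong (2 * p *_) (sym (ℕ.m∸n+n≡m (ℕ.m^n>0 2 (suc m)))) ⟩
  2 * p * (2 * p ∸ 1 + 1)                 ≡⟨ factor p (2 * p ∸ 1) ⟩
  2 * (p * (2 * p ∸ 1)) + 2 * p           ∎))
  where
  open ≡-Reasoning
  p = 2 ^ m
  factor : ∀ p d → 2 * p * (d + 1) ≡ 2 * (p * d) + 2 * p
  factor = solve-∀ ℕ-ring

≈ᶠ-setoid : ℕ → Setoid 0ℓ 0ℓ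
≈ᶠ-setoid n = record
  { Carrier       = Form n
  ; _≈_           = _≈ᶠ_
  ; isEquivalence = record { refl = λ _ → refl ; sym = λ h x → sym (h x) ; trans = λ h h' x → trans (h x) (h' x) }
  }

formsOfType : ∀ n → Sign → List (Form n)
formsOfType n ε = map standardForm (pairsWithDot n (arfOf ε))

formsOfType-type : ∀ n ε → All (Qε ε) (formsOfType n ε)
formsOfType-type n ε = All.map⁺
  (All.map (λ { {a , b} e → standardForm-quadratic (a , b) , trans (arf-standardForm a b) e })
           (pairsWithDot-dot n (arfOf ε)))

formsOfType-unique : ∀ n ε → Unique[ ≈ᶠ-setoid n ] (formsOfType n ε)
formsOfType-unique n ε =
  UniqueSetoid.map⁺ (≡.setoid _) (≈ᶠ-setoid n) standardForm-injective (pairsWithDot-unique n (arfOf ε))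

length-formsOfType : ∀ m ε → length (formsOfType (suc m) ε) ≡ cardQ (suc m) ε
length-formsOfType m ε =
  trans (length-map standardForm (pairsWithDot (suc m) (arfOf ε))) (#pairsWithDot≡cardQ m ε)

-- Covering is only asked up to double negation, since membership in a subset of
-- forms need not be decidable.
Qε-not-coverable : ∀ m ε (φs : List (Form (suc m))) → length φs < cardQ (suc m) ε →
                   ¬ (∀ β → Qε ε β → ¬ ¬ Any (β ≈ᶠ_) φs)
Qε-not-coverable m ε φs φs<card covers =
  All.mapM 0ℓ ¬¬-Monad (λ {β} qβ → covers β qβ) (formsOfType-type (suc m) ε) λ forms⊆φs →
    ℕ.<⇒≱ (subst (length φs <_) (sym (length-formsOfType m ε)) φs<card)
          (unique-⊆⇒length≤ (≈ᶠ-setoid (suc m)) (formsOfType-unique (suc m) ε) forms⊆φs)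

module _ {n} {Δ : FSet n} {α₀ : Form n} {αs : List (Form n)} (Δ-αs : All Δ αs) where

  agreement-invariant : Δ α₀ → (∀ φ → Δ φ → Any (φ ≈ᶠ_) αs) →
                        ∀ g → InStab Δ g → ∀ x →
                        agreement α₀ αs x ≡ true → agreement α₀ αs (act g x) ≡ true
  agreement-invariant Δα₀ cover g g∈XΔ x x∈W =
    All⇒agreement α₀ (All.map (λ Δα → trans (moved Δα) (sym (moved Δα₀))) Δ-αs)
    where
    moved : ∀ {α} → Δ α → α (act g x) ≡ α₀ x
    moved {α} Δα =
      let γx≡α₀x , αg≈γ = lookupAny (agreement⇒All α₀ x∈W) (cover _ (proj₂ (g∈XΔ α) Δα))
      in trans (αg≈γ x) γx≡α₀x

  agreement-trivial⇒≈ψ : (ψ β : Form n) → IsQuadratic ψ → IsQuadratic β →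
    (∀ g → InStab Δ g → InFormStab ψ g) → (∀ x → agreement α₀ αs x ≡ true → x ≡ 𝟎 n) →
    (∀ α → Δ α → Σ (Sp n) λ g → InStab Δ g × ((α ^ᶠ g) ≈ᶠ α₀) × ((β ^ᶠ g) ≈ᶠ β)) →
    β ≈ᶠ ψ
  agreement-trivial⇒≈ψ ψ β qψ qβ XΔ≤Xψ W-trivial move x = xor≡false⇒≡ (begin
    β x xor ψ x  ≡⟨ sym (B-dual ℓ ℓ-linear x) ⟩
    B v x        ≡⟨ cong (λ u → B u x) (W-trivial v v∈W) ⟩
    B (𝟎 n) x    ≡⟨ B-zeroˡ x ⟩
    false        ∎)
    where
    open ≡-Reasoning
    ℓ = λ x → β x xor ψ x
    ℓ-linear = quadratic-difference-linear β ψ qβ qψ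
    v = dual ℓ
    agrees : ∀ {α} → Δ α → α v ≡ α₀ v
    agrees {α} Δα with g , g∈XΔ , αᵍ≈α₀ , βᵍ≈β ← move α Δα =
      trans (cong α (sym (dual-fixed g ℓ ℓ-linear λ z → cong₂ _xor_ (βᵍ≈β z) (XΔ≤Xψ g g∈XΔ z))))
            (αᵍ≈α₀ v)
    v∈W : agreement α₀ αs v ≡ true
    v∈W = All⇒agreement α₀ (All.map agrees Δ-αs)

theorem6p14 : (n : ℕ) → 2 ≤ n → (ε : Sign) → (k : ℕ) → 2 ≤ k → k + 2 ≤ cardQ n ε →
    (Γ : FSet n → Set) → StronglyIncidenceTransitive n ε k Γ →
    (∀ Δ → Γ Δ → Irreducible (InStab Δ)) →
    ∀ Δ → Γ Δ → ∀ (ψ : Form n) → Q ψ → ¬ (∀ g → InStab Δ g → InFormStab ψ g)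
theorem6p14 (suc m) _ ε k (s≤s (s≤s _)) k+2≤card Γ sit irreducible Δ ΓΔ ψ qψ XΔ≤Xψ
  with StronglyIncidenceTransitive.ksubsets sit Δ ΓΔ
... | _ , _ , [] , () , _
... | _ , _ , _ ∷ [] , () , _
... | _ , Δ⊆Qε , α₀ ∷ α₁ ∷ rest , refl , Δ-αs , α₀≉αs ∷ _ , cover =
  Qε-not-coverable m ε (ψ ∷ αs) (subst (_≤ cardQ (suc m) ε) (ℕ.+-comm k 2) k+2≤card) λ β qβ →
    ¬¬-map (locate β qβ) ¬¬-excluded-middle
  where
  αs = α₀ ∷ α₁ ∷ rest
  qαs : All IsQuadratic αs
  qαs = All.map (λ {α} Δα → proj₁ (Δ⊆Qε α Δα)) Δ-αs
  W-trivial : ∀ x → agreement α₀ αs x ≡ true → x ≡ 𝟎 (suc m)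
  W-trivial = fromInj₁ (λ full → contradiction full (agreement-proper (All.head α₀≉αs)))
    (irreducible Δ ΓΔ (agreement α₀ αs) (agreement-subspace (All.head qαs) qαs)
                 (agreement-invariant Δ-αs (All.head Δ-αs) cover))
  outside : ∀ β → Qε ε β → ¬ Δ β → β ≈ᶠ ψ
  outside β qβ β∉Δ = agreement-trivial⇒≈ψ Δ-αs ψ β qψ (proj₁ qβ) XΔ≤Xψ W-trivial λ α Δα →
    StronglyIncidenceTransitive.flagTrans sit Δ ΓΔ α β α₀ β Δα qβ β∉Δ (All.head Δ-αs) qβ β∉Δ
  locate : ∀ β → Qε ε β → Dec (Δ β) → Any (β ≈ᶠ_) (ψ ∷ αs)
  locate β _  (yes Δβ)  = there (cover β Δβ)
  locate β qβ (no β∉Δ) = here (outside β qβ β∉Δ)
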